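{- Let $N\ge0$, $k\ge1$, $X=\{0,\ldots,N\}^k$, and let $f$ be a feasibility function on $X$. Then $\textsc{ParetoEnumerate}$ run on $f$ always terminates, and the set $P$ it returns is exactly the set of all Pareto points of $f$.
   Context: $X$ is ordered componentwise: $\vec x\leq_k\vec x'$ iff $x_i\le x'_i$ for all $i$. A feasibility function is a monotone $f:X\to\{\mathbf{true},\mathbf{false}\}$ (if $f(\vec x)=\mathbf{true}$ and $\vec x\leq_k\vec x'$ then $f(\vec x')=\mathbf{true}$). A Pareto point is $\vec x$ with $f(\vec x)=\mathbf{true}$ and $f(\vec x')=\mathbf{false}$ for all $\vec x'\ne\vec x$ with $\vec x'\leq_k\vec x$. $\textsc{SearchParetoPoint}(\vec x)$: for $i=1,\ldots,k$: $\mathit{max}\gets x_i+1$, $\mathit{min}\gets0$; while $\mathit{max}-\mathit{min}>1$: $\mathit{mid}\gets\mathit{min}+\lfloor(\mathit{max}-\mathit{min}-1)/2\rfloor$, $x_i\gets\mathit{mid}$, if $f(\vec x)=\mathbf{true}$ then $\mathit{max}\gets\mathit{mid}+1$ else $\mathit{min}\gets\mathit{mid}+1$; then $x_i\gets\mathit{min}$. Return $\vec x$. $\textsc{RemoveDominatingElements}(S')$ returns the set of those $\vec x\in S'$ for which there is no $\vec y\in S'$ with $\vec x\leq_k\vec y$ and $\vec x\neq\vec y$. $\textsc{ParetoEnumerate}$: initialize $S\gets\{(N,\ldots,N)\}$, $P\gets\emptyset$. Main loop: while $S\neq\emptyset$: pick (without removing) some $\vec x\in S$; if $f(\vec x)=\mathbf{true}$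 then: $\vec x\gets\textsc{SearchParetoPoint}(\vec x)$; $P\gets P\cup\{\vec x\}$; $S'\gets\emptyset$; for each $\vec y\in S$: if not $\vec x\leq_k\vec y$, add $\vec y$ to $S'$; otherwise, for each $i\in\{1,\ldots,k\}$ with $x_i>0$ add $(y_1,\ldots,y_{i-1},x_i-1,y_{i+1},\ldots,y_k)$ to $S'$; then $S\gets\textsc{RemoveDominatingElements}(S')$. Otherwise set $S\gets S\setminus\{\vec x\}$. When the loop ends, return $P$. -}

module Defs where

open import Data.Bool using (Bool; true; false; if_then_else_)
open import Data.Nat using (ℕ; zero; suc; _+_; _∸_; _<ᵇ_; ⌊_/2⌋)
open import Data.Fin as Fin using (Fin; toℕ; fromℕ; inject₁)
import Data.Fin.Properties as FinP
open import Data.Vec using (Vec; lookup; _[_]≔_; replicate)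
open import Data.Vec.Properties using (≡-dec)
open import Data.Vec.Relation.Binary.Pointwise.Inductive using (Pointwise)
import Data.Vec.Relation.Binary.Pointwise.Inductive as PW
open import Data.List using (List; []; _∷_; [_]; filter; foldl; allFin; concatMap; mapMaybe)
open import Data.List.Relation.Unary.Any using (any?)
open import Data.Maybe using (Maybe; just; nothing)
import Data.Maybe as Maybe
open import Data.List.Membership.Propositional using (_∈_)
open import Data.Product using (_×_; _,_)
open import Relation.Nullary using (Dec; yes; no; ¬_; ¬?; _×-dec_)
open import Relation.Binary.PropositionalEquality using (_≡_; _≢_)

X : ℕ → ℕ → Set
X N k = Vec (Fin (suc N)) k

module _ {N k : ℕ} where

  _≤ₖ_ : X N k → X N k → Set
  x ≤ₖ y = Pointwise Fin._≤_ x y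

  _≤ₖ?_ : (x y : X N k) → Dec (x ≤ₖ y)
  x ≤ₖ? y = PW.decidable FinP._≤?_ x y

  _≟ₖ_ : (x y : X N k) → Dec (x ≡ y)
  _≟ₖ_ = ≡-dec FinP._≟_

  -- feasibility function: monotone Boolean function on X
  Monotone : (X N k → Bool) → Set
  Monotone f = ∀ x x' → f x ≡ true → x ≤ₖ x' → f x' ≡ true

  IsPareto : (X N k → Bool) → X N k → Set
  IsPareto f x = f x ≡ true × (∀ x' → x' ≢ x → x' ≤ₖ x → f x' ≡ false)

-- the natural number m as an element of {0,…,N} (only used for m ≤ N,
-- where toℕ (cap N m) ≡ m)
cap : (N m : ℕ) → Fin (suc N)
cap N       zero    = Fin.zero
cap zero    (suc m) = Fin.zero
cap (suc N) (suc m) = Fin.suc (cap N m)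

-- the while loop of SearchParetoPoint, with the test g mid = f(x with x_i := mid).
-- The fuel argument is only a termination device: started with fuel = max - min
-- it never runs out (each iteration decreases max - min by at least 1).
bsearch : (fuel : ℕ) → (ℕ → Bool) → (min max : ℕ) → ℕ
bsearch zero       g min max = min
bsearch (suc fuel) g min max with 1 <ᵇ (max ∸ min)
... | false = min
... | true  =
  let mid = min + ⌊ (max ∸ min ∸ 1) /2⌋ in
  if g mid then bsearch fuel g min (suc mid) else bsearch fuel g (suc mid) max

module _ {N k : ℕ} (f : X N k → Bool) where

  searchCoord : X N k → Fin k → X N k
  searchCoord x i =
    let mx  = suc (toℕ (lookup x i))
        res = bsearch mx (λ m → f (x [ i ]≔ cap N m)) 0 mx
    in x [ i ]≔ cap N res

  SearchParetoPoint : X N k → X N k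
  SearchParetoPoint x = foldl searchCoord x (allFin k)

  RemoveDominatingElements : List (X N k) → List (X N k)
  RemoveDominatingElements S' =
    filter (λ x → ¬? (any? (λ y → (x ≤ₖ? y) ×-dec ¬? (x ≟ₖ y)) S')) S'

  decr : Fin (suc N) → Maybe (Fin (suc N))
  decr Fin.zero    = nothing
  decr (Fin.suc j) = just (inject₁ j)

  -- contribution of y ∈ S to S' after finding Pareto point x
  newElems : X N k → X N k → List (X N k)
  newElems x y with x ≤ₖ? y
  ... | no  _ = [ y ]
  ... | yes _ = mapMaybe (λ i → Maybe.map (λ xi-1 → y [ i ]≔ xi-1) (decr (lookup x i))) (allFin k)

  State : Set
  State = List (X N k) × List (X N k)

  -- one iteration of the main while-loop; the choice of x ∈ S is nondeterministic
  data Step : State → State → Set where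
    feasible : ∀ {S P x} → x ∈ S → f x ≡ true →
      let x' = SearchParetoPoint x in
      Step (S , P) (RemoveDominatingElements (concatMap (newElems x') S) , x' ∷ P)
    infeasible : ∀ {S P x} → x ∈ S → f x ≡ false →
      Step (S , P) (filter (λ y → ¬? (y ≟ₖ x)) S , P)

  initial : State
  initial = [ replicate k (fromℕ N) ] , []

module Submission where

-- The main loop maintains, for its state (S , P), three invariants:
--   * soundness:   every element of P is a Pareto point;
--   * coverage:    every Pareto point is in P or lies below some element of S;
--   * separation:  no element of P lies below an element of S.
-- A feasible step adds the Pareto point x' = SearchParetoPoint x (correct by
-- the binary-search specification and a tightness argument per coordinate)
-- and replaces every y ≥ x' by the points "y with coordinate i set to x'ᵢ - 1",
-- which still cover every Pareto point except x' itself; RemoveDominatingElements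
-- keeps a maximal element above each removed one.  Termination follows from the
-- lexicographic measure (number of points of X above no element of P , |S|):
-- by separation a feasible step shrinks the first component, an infeasible step
-- keeps P and shrinks S.  When S = [] coverage says every Pareto point is in P.

open import Defs
open import Data.Bool using (Bool; true; false)
open import Data.Nat as ℕ using (ℕ; zero; suc; _≥_; _+_; _*_; _∸_; ⌊_/2⌋; z≤n; s≤s; s≤s⁻¹)
import Data.Nat.Properties as ℕP
open import Data.Nat.Induction using (<-wellFounded)
open import Data.Fin as Fin using (Fin; toℕ; fromℕ)
import Data.Fin.Properties as FinP
open import Data.Vec using ([]; _∷_; lookup; _[_]≔_; replicate)
open import Data.Vec.Properties using ([]≔-lookup; lookup∘update)
open import Data.Vec.Relation.Binary.Pointwise.Inductive using ([]; _∷_)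
import Data.Vec.Relation.Binary.Pointwise.Inductive as PW
open import Data.List as List using (List; []; _∷_; [_]; filter; allFin; concatMap; mapMaybe; length; cartesianProductWith)
open import Data.List.Properties using (filter-notAll)
open import Data.List.Relation.Unary.Any using (here; there; any?)
open import Data.List.Membership.Propositional using (_∈_; lose; find)
open import Data.List.Membership.Propositional.Properties
  using (∈-filter⁺; ∈-filter⁻; ∈-concatMap⁺; ∈-concatMap⁻; ∈-allFin; ∈-cartesianProductWith⁺)
open import Data.Maybe as Maybe using (Maybe; just; nothing)
open import Data.Product using (_×_; _,_; ∃; ∃₂; proj₁; proj₂)
open import Data.Product.Relation.Binary.Lex.Strict using (×-Lex; ×-wellFounded)
open import Data.Sum using (_⊎_; inj₁; inj₂)
open import Function using (flip; _∘_)
open import Function.Bundles using (_⇔_; mk⇔)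
open import Induction.WellFounded using (Acc; acc; WellFounded; module Subrelation)
import Relation.Binary.Construct.On as On
open import Relation.Binary.Construct.Closure.ReflexiveTransitive using (Star; ε; _◅_)
open import Relation.Nullary using (yes; no; ¬_; ¬?; _×-dec_; contradiction)
open import Relation.Binary.PropositionalEquality using (_≡_; _≢_; refl; sym; trans; cong; cong₂; subst; module ≡-Reasoning)

private
  variable
    N k : ℕ

false-downward : ∀ {a b : Bool} → (a ≡ true → b ≡ true) → b ≡ false → a ≡ false
false-downward {false} _  _       = refl
false-downward {true}  up b-false = trans (sym (up refl)) b-false

≤ₖ-refl : (x : X N k) → x ≤ₖ x
≤ₖ-refl x = PW.refl FinP.≤-refl

≤ₖ-trans : {x y z : X N k} → x ≤ₖ y → y ≤ₖ z → x ≤ₖ z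
≤ₖ-trans = PW.trans FinP.≤-trans

≤ₖ-antisym : {x y : X N k} → x ≤ₖ y → y ≤ₖ x → x ≡ y
≤ₖ-antisym []       []       = refl
≤ₖ-antisym (p ∷ ps) (q ∷ qs) = cong₂ _∷_ (FinP.≤-antisym p q) (≤ₖ-antisym ps qs)

≤ₖ-top : (x : X N k) → x ≤ₖ replicate k (fromℕ N)
≤ₖ-top []      = []
≤ₖ-top (a ∷ x) = FinP.≤fromℕ a ∷ ≤ₖ-top x

≰ₖ-witness : (x y : X N k) → ¬ x ≤ₖ y → ∃ λ i → lookup y i Fin.< lookup x i
≰ₖ-witness []      []      x≰y = contradiction [] x≰y
≰ₖ-witness (a ∷ x) (b ∷ y) x≰y with a FinP.≤? b
... | no  a≰b = Fin.zero , ℕP.≰⇒> a≰b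
... | yes a≤b = let i , lt = ≰ₖ-witness x y (λ x≤y → x≰y (a≤b ∷ x≤y)) in Fin.suc i , lt

<ₖ-witness : {x y : X N k} → x ≤ₖ y → x ≢ y → ∃ λ i → lookup x i Fin.< lookup y i
<ₖ-witness {x = x} {y} x≤y x≢y = ≰ₖ-witness y x (λ y≤x → x≢y (≤ₖ-antisym x≤y y≤x))

update-mono : ∀ {x y : X N k} i {a b} → x ≤ₖ y → a Fin.≤ b → (x [ i ]≔ a) ≤ₖ (y [ i ]≔ b)
update-mono Fin.zero    (_ ∷ ps) a≤b = a≤b ∷ ps
update-mono (Fin.suc i) (p ∷ ps) a≤b = p ∷ update-mono i ps a≤b

≤-update : ∀ {z y : X N k} i {v} → z ≤ₖ y → lookup z i Fin.≤ v → z ≤ₖ (y [ i ]≔ v)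
≤-update {z = z} i z≤y le = subst (_≤ₖ _) ([]≔-lookup z i) (update-mono i z≤y le)

update-≤ : ∀ (y : X N k) i {v} → v Fin.≤ lookup y i → (y [ i ]≔ v) ≤ₖ y
update-≤ y i {v} le = subst ((y [ i ]≔ v) ≤ₖ_) ([]≔-lookup y i) (update-mono i (≤ₖ-refl y) le)

-- The weight (coordinate sum) strictly increases along the strict order and is
-- bounded by k · N, so X has no infinite strictly ascending chains.
weight : X N k → ℕ
weight []      = 0
weight (a ∷ x) = toℕ a + weight x

weight-bound : (x : X N k) → weight x ℕ.≤ k * N
weight-bound []      = z≤n
weight-bound (a ∷ x) = ℕP.+-mono-≤ (FinP.toℕ≤pred[n] a) (weight-bound x)

weight-mono : {x y : X N k} → x ≤ₖ y → weight x ℕ.≤ weight y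
weight-mono []       = z≤n
weight-mono (p ∷ ps) = ℕP.+-mono-≤ p (weight-mono ps)

weight-strict : {x y : X N k} → x ≤ₖ y → x ≢ y → weight x ℕ.< weight y
weight-strict {x = []}    {[]}    []       x≢y = contradiction refl x≢y
weight-strict {x = a ∷ x} {b ∷ y} (p ∷ ps) x≢y with a FinP.≟ b
... | yes refl = ℕP.+-monoʳ-< (toℕ a) (weight-strict ps (λ x≡y → x≢y (cong (a ∷_) x≡y)))
... | no  a≢b  = ℕP.+-mono-<-≤ (FinP.≤∧≢⇒< p a≢b) (weight-mono ps)

_<ₖ_ : X N k → X N k → Set
x <ₖ y = x ≤ₖ y × x ≢ y

<ₖ-ascending-wf : WellFounded (flip (_<ₖ_ {N} {k}))
<ₖ-ascending-wf {N} {k} =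
  Subrelation.wellFounded room-shrinks (On.wellFounded room <-wellFounded)
  where
    room : X N k → ℕ
    room x = k * N ∸ weight x
    room-shrinks : ∀ {y x} → x <ₖ y → room y ℕ.< room x
    room-shrinks {y} (x≤y , x≢y) = ℕP.∸-monoʳ-< (weight-strict x≤y x≢y) (weight-bound y)

cap-toℕ : ∀ N (a : Fin (suc N)) → cap N (toℕ a) ≡ a
cap-toℕ N       Fin.zero    = refl
cap-toℕ (suc N) (Fin.suc a) = cong Fin.suc (cap-toℕ N a)

toℕ-cap≤ : ∀ N m → toℕ (cap N m) ℕ.≤ m
toℕ-cap≤ N       zero    = z≤n
toℕ-cap≤ zero    (suc m) = z≤n
toℕ-cap≤ (suc N) (suc m) = s≤s (toℕ-cap≤ N m)

cap-mono : ∀ N {m n} → m ℕ.≤ n → cap N m Fin.≤ cap N n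
cap-mono N       {zero}           _         = z≤n
cap-mono zero    {suc m} {suc n}  _         = z≤n
cap-mono (suc N) {suc m} {suc n}  (s≤s m≤n) = s≤s (cap-mono N m≤n)

Least : (ℕ → Bool) → ℕ → Set
Least g r = g r ≡ true × (∀ m → m ℕ.< r → g m ≡ false)

least-≤ : ∀ {g r n} → Least g r → g n ≡ true → r ℕ.≤ n
least-≤ {r = r} {n} (_ , below) g-n with r ℕP.≤? n
... | yes r≤n = r≤n
... | no  r≰n with () ← trans (sym g-n) (below n (ℕP.≰⇒> r≰n))

module BinarySearch (g : ℕ → Bool) (g-mono : ∀ {m n} → m ℕ.≤ n → g m ≡ true → g n ≡ true) where

  private
    -- bsearch on [lo, lo + d] sees an interval of width max - min = d + 1
    width : ∀ lo d → suc (lo + d) ∸ lo ≡ suc d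
    width lo d = trans (ℕP.+-∸-assoc 1 (ℕP.m≤m+n lo d)) (cong suc (ℕP.m+n∸m≡n lo d))

    -- so on [lo, lo + suc d] it tests the midpoint lo + ⌊ (d + 1) / 2 ⌋
    half : ∀ lo d → ⌊ (suc (lo + suc d) ∸ lo ∸ 1) /2⌋ ≡ ⌊ suc d /2⌋
    half lo d = cong (λ n → ⌊ n ∸ 1 /2⌋) (width lo (suc d))

    -- after a failed test at lo + h the interval becomes [lo + h + 1, lo + suc d]
    split : ∀ lo h d → h ℕ.≤ d → lo + suc d ≡ suc (lo + h) + (d ∸ h)
    split lo h d h≤d = begin
      lo + suc d               ≡⟨ ℕP.+-suc lo d ⟩
      suc (lo + d)             ≡⟨ cong (λ n → suc (lo + n)) (sym (ℕP.m+[n∸m]≡n h≤d)) ⟩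
      suc (lo + (h + (d ∸ h))) ≡⟨ cong suc (sym (ℕP.+-assoc lo h (d ∸ h))) ⟩
      suc (lo + h) + (d ∸ h)   ∎
      where open ≡-Reasoning

  bsearch-least : ∀ fuel lo d → d ℕ.< fuel → g (lo + d) ≡ true → (∀ m → m ℕ.< lo → g m ≡ false) →
                  Least g (bsearch fuel g lo (suc (lo + d)))
  bsearch-least zero       _  _       ()     _     _
  bsearch-least (suc fuel) lo zero    _      g-top below rewrite width lo zero =
    subst (λ n → g n ≡ true) (ℕP.+-identityʳ lo) g-top , below
  bsearch-least (suc fuel) lo (suc d) d<fuel g-top below rewrite width lo (suc d)
    with g (lo + ⌊ (suc (lo + suc d) ∸ lo ∸ 1) /2⌋) in g-mid
  ... | true  = bsearch-least fuel lo h h<fuel g-mid below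
    where
      h = ⌊ (suc (lo + suc d) ∸ lo ∸ 1) /2⌋
      h<fuel : h ℕ.< fuel
      h<fuel = subst (ℕ._< fuel) (sym (half lo d)) (ℕP.<-≤-trans (ℕP.⌊n/2⌋<n d) (s≤s⁻¹ d<fuel))
  ... | false = subst (λ n → Least g (bsearch fuel g (suc (lo + h)) (suc n))) (sym (split lo h d h≤d))
                  (bsearch-least fuel (suc (lo + h)) (d ∸ h)
                     (ℕP.≤-<-trans (ℕP.m∸n≤m d h) (s≤s⁻¹ d<fuel))
                     (subst (λ n → g n ≡ true) (split lo h d h≤d) g-top)
                     below-mid)
    where
      h = ⌊ (suc (lo + suc d) ∸ lo ∸ 1) /2⌋
      h≤d : h ℕ.≤ d
      h≤d = subst (ℕ._≤ d) (sym (half lo d)) (s≤s⁻¹ (ℕP.⌊n/2⌋<n d))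
      below-mid : ∀ m → m ℕ.< suc (lo + h) → g m ≡ false
      below-mid m m≤mid = false-downward (g-mono (s≤s⁻¹ m≤mid)) g-mid

module _ {A B C : Set} (m : A → Maybe B) (g : A → B → C) where

  ∈-mapMaybe⁺ : ∀ {a v} (L : List A) → a ∈ L → m a ≡ just v → g a v ∈ mapMaybe (λ a → Maybe.map (g a) (m a)) L
  ∈-mapMaybe⁺ (a ∷ L) (here refl) m-a rewrite m-a = here refl
  ∈-mapMaybe⁺ (b ∷ L) (there a∈L) m-a with m b
  ... | just _  = there (∈-mapMaybe⁺ L a∈L m-a)
  ... | nothing = ∈-mapMaybe⁺ L a∈L m-a

  ∈-mapMaybe⁻ : ∀ {w} (L : List A) → w ∈ mapMaybe (λ a → Maybe.map (g a) (m a)) L →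
                ∃₂ λ a v → m a ≡ just v × w ≡ g a v
  ∈-mapMaybe⁻ (a ∷ L) w∈ with m a in m-a
  ... | nothing = ∈-mapMaybe⁻ L w∈
  ... | just v with w∈
  ...   | here refl  = a , v , m-a , refl
  ...   | there w∈′ = ∈-mapMaybe⁻ L w∈′

allX : (k : ℕ) → List (X N k)
allX zero    = [ [] ]
allX (suc k) = cartesianProductWith _∷_ (allFin _) (allX k)

allX-complete : (x : X N k) → x ∈ allX k
allX-complete []      = here refl
allX-complete (a ∷ x) = ∈-cartesianProductWith⁺ _∷_ (∈-allFin a) (allX-complete x)

_<ₗₑₓ_ : ℕ × ℕ → ℕ × ℕ → Set
_<ₗₑₓ_ = ×-Lex _≡_ ℕ._<_ ℕ._<_

measure-terminates : ∀ {A : Set} (_⇝_ : A → A → Set) (Inv : A → Set) (μ : A → ℕ × ℕ) →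
  (∀ {s t} → s ⇝ t → Inv s → Inv t) →
  (∀ {s t} → s ⇝ t → Inv s → μ t <ₗₑₓ μ s) →
  ∀ {s} → Inv s → Acc (flip _⇝_) s
measure-terminates _⇝_ Inv μ preserve decrease {s} =
  go (×-wellFounded <-wellFounded <-wellFounded (μ s))
  where
    go : ∀ {s} → Acc _<ₗₑₓ_ (μ s) → Inv s → Acc (flip _⇝_) s
    go (acc smaller) inv = acc λ step → go (smaller (decrease step inv)) (preserve step inv)

module Correctness {N k : ℕ} (f : X N k → Bool) (mono : Monotone f) where

  infeasible-below : ∀ {z w} → z ≤ₖ w → f w ≡ false → f z ≡ false
  infeasible-below z≤w = false-downward (λ f-z → mono _ _ f-z z≤w)

  Tight : Fin k → X N k → Set
  Tight i y = ∀ z → z ≤ₖ y → lookup z i Fin.< lookup y i → f z ≡ false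

  tight-down : ∀ {i y y′} → y′ ≤ₖ y → Tight i y → Tight i y′
  tight-down {i} y′≤y tight z z≤y′ lt =
    tight z (≤ₖ-trans z≤y′ y′≤y) (ℕP.<-≤-trans lt (PW.lookup y′≤y i))

  searchCoord-spec : ∀ x i → f x ≡ true →
    let y = searchCoord f x i in f y ≡ true × y ≤ₖ x × Tight i y
  searchCoord-spec x i f-x = proj₁ least , y≤x , tight
    where
      top = toℕ (lookup x i)
      g : ℕ → Bool
      g m = f (x [ i ]≔ cap N m)
      g-top : g top ≡ true
      g-top = subst (λ c → f (x [ i ]≔ c) ≡ true) (sym (cap-toℕ N (lookup x i)))
                (subst (λ z → f z ≡ true) (sym ([]≔-lookup x i)) f-x)
      least : Least g (bsearch (suc top) g 0 (suc top))
      least = BinarySearch.bsearch-least g (λ m≤n g-m → mono _ _ g-m (update-mono i (≤ₖ-refl x) (cap-mono N m≤n)))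
                (suc top) 0 top ℕP.≤-refl g-top (λ _ ())
      r = bsearch (suc top) g 0 (suc top)
      y≤x : (x [ i ]≔ cap N r) ≤ₖ x
      y≤x = update-≤ x i (subst (cap N r Fin.≤_) (cap-toℕ N (lookup x i)) (cap-mono N (least-≤ least g-top)))
      tight : Tight i (x [ i ]≔ cap N r)
      tight z z≤y lt = infeasible-below z≤x[i]≔zᵢ (proj₂ least (toℕ (lookup z i)) zᵢ<r)
        where
          zᵢ<r : toℕ (lookup z i) ℕ.< r
          zᵢ<r = ℕP.<-≤-trans (subst (λ c → lookup z i Fin.< c) (lookup∘update i x (cap N r)) lt) (toℕ-cap≤ N r)
          z≤x[i]≔zᵢ : z ≤ₖ (x [ i ]≔ cap N (toℕ (lookup z i)))
          z≤x[i]≔zᵢ = subst (λ c → z ≤ₖ (x [ i ]≔ c)) (sym (cap-toℕ N (lookup z i)))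
                        (≤-update i (≤ₖ-trans z≤y y≤x) FinP.≤-refl)

  searchCoords-spec : ∀ (L : List (Fin k)) x → f x ≡ true →
    let y = List.foldl (searchCoord f) x L in f y ≡ true × y ≤ₖ x × (∀ j → j ∈ L → Tight j y)
  searchCoords-spec []      x f-x = f-x , ≤ₖ-refl x , λ _ ()
  searchCoords-spec (i ∷ L) x f-x =
    let f-y , y≤x , tight-i = searchCoord-spec x i f-x
        f-z , z≤y , tight-L = searchCoords-spec L (searchCoord f x i) f-y
    in f-z , ≤ₖ-trans z≤y y≤x , λ { j (here refl) → tight-down z≤y tight-i ; j (there j∈L) → tight-L j j∈L }

  SearchParetoPoint-spec : ∀ x → f x ≡ true →
    IsPareto f (SearchParetoPoint f x) × SearchParetoPoint f x ≤ₖ x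
  SearchParetoPoint-spec x f-x =
    let f-y , y≤x , tight = searchCoords-spec (allFin k) x f-x
    in (f-y , λ z z≢y z≤y → let j , lt = <ₖ-witness z≤y z≢y in tight j (∈-allFin j) z z≤y lt) , y≤x

  decr-< : ∀ {a v : Fin (suc N)} → decr f a ≡ just v → v Fin.< a
  decr-< {Fin.suc a} refl = FinP.≤̄⇒inject₁< FinP.≤-refl

  decr-≥ : ∀ {a b : Fin (suc N)} → b Fin.< a → ∃ λ v → decr f a ≡ just v × b Fin.≤ v
  decr-≥ {Fin.suc a} b<a = _ , refl , FinP.<⇒≤pred b<a

  newElems-sound : ∀ x y {w} → w ∈ newElems f x y → w ≤ₖ y × ¬ x ≤ₖ w
  newElems-sound x y w∈ with x ≤ₖ? y
  newElems-sound x y (here refl) | no x≰y = ≤ₖ-refl y , x≰y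
  ... | yes x≤y with ∈-mapMaybe⁻ (λ i → decr f (lookup x i)) (λ i v → y [ i ]≔ v) (allFin k) w∈
  ... | i , v , decr-xᵢ , refl =
          update-≤ y i (ℕP.<⇒≤ (ℕP.<-≤-trans (decr-< decr-xᵢ) (PW.lookup x≤y i)))
        , λ x≤w → ℕP.<⇒≱ (decr-< decr-xᵢ) (subst (lookup x i Fin.≤_) (lookup∘update i y v) (PW.lookup x≤w i))

  newElems-complete : ∀ x y {q} → q ≤ₖ y → ¬ x ≤ₖ q → ∃ λ w → w ∈ newElems f x y × q ≤ₖ w
  newElems-complete x y {q} q≤y x≰q with x ≤ₖ? y
  ... | no  _ = y , here refl , q≤y
  ... | yes _ with ≰ₖ-witness x q x≰q
  ... | i , qᵢ<xᵢ with decr-≥ qᵢ<xᵢ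
  ... | v , decr-xᵢ , qᵢ≤v =
          y [ i ]≔ v
        , ∈-mapMaybe⁺ (λ i → decr f (lookup x i)) (λ i v → y [ i ]≔ v) (allFin k) (∈-allFin i) decr-xᵢ
        , ≤-update i q≤y qᵢ≤v

  removeDominating-⊆ : ∀ S′ {w} → w ∈ RemoveDominatingElements f S′ → w ∈ S′
  removeDominating-⊆ S′ w∈ = proj₁ (∈-filter⁻ _ w∈)

  removeDominating-max : ∀ S′ {w} → w ∈ S′ → ∃ λ w′ → w′ ∈ RemoveDominatingElements f S′ × w ≤ₖ w′
  removeDominating-max S′ {w} = climb (<ₖ-ascending-wf w)
    where
      climb : ∀ {w} → Acc (flip _<ₖ_) w → w ∈ S′ → ∃ λ w′ → w′ ∈ RemoveDominatingElements f S′ × w ≤ₖ w′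
      climb {w} (acc above) w∈ with any? (λ y → (w ≤ₖ? y) ×-dec ¬? (w ≟ₖ y)) S′
      ... | no  maximal    = w , ∈-filter⁺ _ w∈ maximal , ≤ₖ-refl w
      ... | yes dominated with find dominated
      ... | y , y∈ , w<y =
              let w′ , w′∈ , y≤w′ = climb (above w<y) y∈ in w′ , w′∈ , ≤ₖ-trans (proj₁ w<y) y≤w′

  record Invariant (S P : List (X N k)) : Set where
    field
      sound     : ∀ p → p ∈ P → IsPareto f p
      covered   : ∀ q → IsPareto f q → q ∈ P ⊎ ∃ (λ y → y ∈ S × q ≤ₖ y)
      separated : ∀ y p → y ∈ S → p ∈ P → ¬ p ≤ₖ y
  open Invariant

  Inv : State f → Set
  Inv (S , P) = Invariant S P

  invariant-initial : Inv (initial f)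
  invariant-initial .sound     _ ()
  invariant-initial .covered   q _ = inj₂ (_ , here refl , ≤ₖ-top q)
  invariant-initial .separated _ _ _ ()

  fresh : ∀ {S P x} → Invariant S P → x ∈ S → f x ≡ true → ∀ p → p ∈ P → ¬ p ≤ₖ SearchParetoPoint f x
  fresh I x∈ f-x p p∈ p≤x′ = I .separated _ p x∈ p∈ (≤ₖ-trans p≤x′ (proj₂ (SearchParetoPoint-spec _ f-x)))

  invariant-step : ∀ {s t} → Step f s t → Inv s → Inv t
  invariant-step {S , P} (feasible {x = x} x∈ f-x) I = record
    { sound     = λ { p (here refl) → x′-pareto ; p (there p∈) → I .sound p p∈ }
    ; covered   = covered′
    ; separated = separated′
    }
    where
      x′ = SearchParetoPoint f x
      x′-pareto = proj₁ (SearchParetoPoint-spec x f-x)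
      S′ = concatMap (newElems f x′) S
      covered′ : ∀ q → IsPareto f q → q ∈ x′ ∷ P ⊎ ∃ (λ y → y ∈ RemoveDominatingElements f S′ × q ≤ₖ y)
      covered′ q q-pareto with I .covered q q-pareto
      ... | inj₁ q∈P = inj₁ (there q∈P)
      ... | inj₂ (y , y∈ , q≤y) with q ≟ₖ x′
      ...   | yes refl = inj₁ (here refl)
      ...   | no  q≢x′ =
              let w , w∈ , q≤w    = newElems-complete x′ y q≤y x′≰q
                  w′ , w′∈ , w≤w′ = removeDominating-max S′ (∈-concatMap⁺ (newElems f x′) (lose y∈ w∈))
              in inj₂ (w′ , w′∈ , ≤ₖ-trans q≤w w≤w′)
        where
          -- x′ is feasible, so it cannot lie strictly below the Pareto point q
          x′≰q : ¬ x′ ≤ₖ q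
          x′≰q x′≤q with () ← trans (sym (proj₁ x′-pareto)) (proj₂ q-pareto x′ (q≢x′ ∘ sym) x′≤q)
      separated′ : ∀ w p → w ∈ RemoveDominatingElements f S′ → p ∈ x′ ∷ P → ¬ p ≤ₖ w
      separated′ w p w∈ p∈ p≤w with find (∈-concatMap⁻ (newElems f x′) {xs = S} (removeDominating-⊆ S′ w∈))
      ... | y , y∈ , w∈y with newElems-sound x′ y w∈y | p∈
      ...   | _   , x′≰w | here refl  = x′≰w p≤w
      ...   | w≤y , _    | there p∈P = I .separated y p y∈ p∈P (≤ₖ-trans p≤w w≤y)
  invariant-step {S , P} (infeasible {x = x} x∈ f-x) I = record
    { sound     = I .sound
    ; covered   = covered′
    ; separated = λ y p y∈ → I .separated y p (proj₁ (∈-filter⁻ _ y∈))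
    }
    where
      covered′ : ∀ q → IsPareto f q → q ∈ P ⊎ ∃ (λ y → y ∈ filter (λ y → ¬? (y ≟ₖ x)) S × q ≤ₖ y)
      covered′ q q-pareto with I .covered q q-pareto
      ... | inj₁ q∈P = inj₁ q∈P
      ... | inj₂ (y , y∈ , q≤y) with y ≟ₖ x
      ...   | no  y≢x = inj₂ (y , ∈-filter⁺ _ y∈ y≢x , q≤y)
      ...   | yes refl with () ← trans (sym (mono q y (proj₁ q-pareto) q≤y)) f-x

  invariant-run : ∀ {s t} → Star (Step f) s t → Inv s → Inv t
  invariant-run ε             I = I
  invariant-run (step ◅ steps) I = invariant-run steps (invariant-step step I)

  undominated : List (X N k) → List (X N k)
  undominated []      = allX k
  undominated (p ∷ P) = filter (λ z → ¬? (p ≤ₖ? z)) (undominated P)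

  ∈-undominated : ∀ P z → (∀ p → p ∈ P → ¬ p ≤ₖ z) → z ∈ undominated P
  ∈-undominated []      z _     = allX-complete z
  ∈-undominated (p ∷ P) z above = ∈-filter⁺ _ (∈-undominated P z (λ p′ p′∈ → above p′ (there p′∈))) (above p (here refl))

  undominated-shrinks : ∀ P x → (∀ p → p ∈ P → ¬ p ≤ₖ x) → length (undominated (x ∷ P)) ℕ.< length (undominated P)
  undominated-shrinks P x fresh-x = filter-notAll _ _ (lose (∈-undominated P x fresh-x) (λ x≰x → x≰x (≤ₖ-refl x)))

  measure : State f → ℕ × ℕ
  measure (S , P) = length (undominated P) , length S

  measure-decreases : ∀ {s t} → Step f s t → Inv s → measure t <ₗₑₓ measure s
  measure-decreases {_ , P} (feasible x∈ f-x) I = inj₁ (undominated-shrinks P _ (fresh I x∈ f-x))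
  measure-decreases {S , _} (infeasible {x = x} x∈ _) _ =
    inj₂ (refl , filter-notAll _ S (lose x∈ (λ x≢x → x≢x refl)))

  terminates : Acc (flip (Step f)) (initial f)
  terminates = measure-terminates (Step f) Inv measure invariant-step measure-decreases invariant-initial

  run : ∀ s → Acc (flip (Step f)) s → ∃ λ P → Star (Step f) s ([] , P)
  run ([] , P)    _          = P , ε
  run (x ∷ S , P) (acc next) with f x in f-x
  ... | true  = let step = feasible   (here refl) f-x ; P′ , steps = run _ (next step) in P′ , step ◅ steps
  ... | false = let step = infeasible (here refl) f-x ; P′ , steps = run _ (next step) in P′ , step ◅ steps

  returns-Pareto-set : ∀ P → Star (Step f) (initial f) ([] , P) → ∀ x → (x ∈ P ⇔ IsPareto f x)
  returns-Pareto-set P steps x = mk⇔ (I .sound x) in-P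
    where
      I = invariant-run steps invariant-initial
      in-P : IsPareto f x → x ∈ P
      in-P x-pareto with I .covered x x-pareto
      ... | inj₁ x∈P = x∈P

corollary1 : (N k : ℕ) → k ≥ 1 → (f : X N k → Bool) → Monotone f →
    Acc (λ t s → Step f s t) (initial f)
    × ∃ (λ P → Star (Step f) (initial f) ([] , P))
    × (∀ P → Star (Step f) (initial f) ([] , P) → ∀ x → (x ∈ P ⇔ IsPareto f x))
corollary1 N k _ f mono = terminates , run (initial f) terminates , returns-Pareto-set
  where open Correctness f mono
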